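{- Let $G=(U,V,E)$ be a finite connected bipartite graph with $|U|\le|V|$ and let $\mathcal{M}$ be a maximal matching of $G$. Then $K_{\mathcal{M}}(G)$ is a minimal vertex cover of $G$, i.e. it is a vertex cover and no proper subset of it is a vertex cover.
   Context: A matching is maximal if no edge of $G$ can be added to it while remaining a matching. A vertex is saturated by $\mathcal{M}$ if it is an endpoint of an edge of $\mathcal{M}$. An alternating path is a path whose edges alternate between edges not in $\mathcal{M}$ and edges in $\mathcal{M}$. $Z_{\mathcal{M}}(G)$ is the set of all vertices reachable by alternating paths starting at vertices of $U$ unsaturated by $\mathcal{M}$ (these start vertices included), and $K_{\mathcal{M}}(G):=(U\setminus Z_{\mathcal{M}}(G))\cup(V\cap Z_{\mathcal{M}}(G))$. A vertex cover is a set of vertices meeting every edge. -}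

module Defs where

open import Data.Nat using (ℕ)
open import Data.Fin using (Fin; _≟_)
open import Data.Bool using (Bool; true; false; not; _∧_; _∨_)
open import Data.Sum using (_⊎_; inj₁; inj₂)
open import Data.Product using (Σ; ∃; _×_; _,_)
open import Data.List using (List; []; _∷_; [_])
open import Data.List.Relation.Unary.Unique.Propositional using (Unique)
open import Relation.Nullary using (¬_)
open import Relation.Nullary.Decidable using (⌊_⌋)
open import Relation.Binary.PropositionalEquality using (_≡_)

-- A finite bipartite graph G = (U, V, E) with U = Fin m, V = Fin n,
-- given by its (decidable) edge relation E u v ≡ true.
BipEdges : ℕ → ℕ → Set
BipEdges m n = Fin m → Fin n → Bool

Vertex : ℕ → ℕ → Set
Vertex m n = Fin m ⊎ Fin n

edge : ∀ {m n} → BipEdges m n → Vertex m n → Vertex m n → Bool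
edge E (inj₁ u) (inj₂ v) = E u v
edge E (inj₂ v) (inj₁ u) = E u v
edge E _ _ = false

Adj : ∀ {m n} → BipEdges m n → Vertex m n → Vertex m n → Set
Adj E x y = edge E x y ≡ true

data Walk {m n} (E : BipEdges m n) : Vertex m n → Vertex m n → Set where
  here : ∀ {x} → Walk E x x
  step : ∀ {x y z} → Adj E x y → Walk E y z → Walk E x z

Connected : ∀ {m n} → BipEdges m n → Set
Connected E = ∀ x y → Walk E x y

IsMatching : ∀ {m n} → BipEdges m n → BipEdges m n → Set
IsMatching E M =
  (∀ u v → M u v ≡ true → E u v ≡ true) ×
  (∀ u v v′ → M u v ≡ true → M u v′ ≡ true → v ≡ v′) ×
  (∀ u u′ v → M u v ≡ true → M u′ v ≡ true → u ≡ u′)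

addEdge : ∀ {m n} → BipEdges m n → Fin m → Fin n → BipEdges m n
addEdge M u v u′ v′ = M u′ v′ ∨ (⌊ u′ ≟ u ⌋ ∧ ⌊ v′ ≟ v ⌋)

IsMaximalMatching : ∀ {m n} → BipEdges m n → BipEdges m n → Set
IsMaximalMatching E M =
  IsMatching E M ×
  (∀ u v → E u v ≡ true → M u v ≡ false → ¬ IsMatching E (addEdge M u v))

Saturated : ∀ {m n} → BipEdges m n → Vertex m n → Set
Saturated M x = ∃ λ y → edge M x y ≡ true

-- Walks whose edges alternate w.r.t. M; the index b says whether the
-- first edge must be in M.
data AltWalk {m n} (E M : BipEdges m n) : Bool → Vertex m n → Vertex m n → Set where
  here : ∀ {b x} → AltWalk E M b x x
  step : ∀ {b x y z} → Adj E x y → edge M x y ≡ b →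
         AltWalk E M (not b) y z → AltWalk E M b x z

altVerts : ∀ {m n} {E M : BipEdges m n} {b x y} → AltWalk E M b x y → List (Vertex m n)
altVerts {x = x} here = [ x ]
altVerts {x = x} (step _ _ w) = x ∷ altVerts w

AltPath : ∀ {m n} → BipEdges m n → BipEdges m n → Vertex m n → Vertex m n → Set
AltPath E M x y = Σ Bool λ b → Σ (AltWalk E M b x y) λ w → Unique (altVerts w)

Z : ∀ {m n} → BipEdges m n → BipEdges m n → Vertex m n → Set
Z E M x = ∃ λ u → ¬ Saturated M (inj₁ u) × AltPath E M (inj₁ u) x

K : ∀ {m n} → BipEdges m n → BipEdges m n → Vertex m n → Set
K E M (inj₁ u) = ¬ Z E M (inj₁ u)
K E M (inj₂ v) = Z E M (inj₂ v)

VertexCover : ∀ {m n} → BipEdges m n → (Vertex m n → Set) → Set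
VertexCover E S = ∀ u v → E u v ≡ true → S (inj₁ u) ⊎ S (inj₂ v)

MinimalVertexCover : ∀ {m n} → BipEdges m n → (Vertex m n → Set) → Set₁
MinimalVertexCover {m} {n} E C =
  VertexCover E C ×
  (∀ (S : Vertex m n → Set) → (∀ x → S x → C x) →
     ¬ ((∃ λ x → C x × ¬ S x) × VertexCover E S))

-- Write Z for Z_M(G). An alternating path from an unsaturated vertex of U leaves
-- U-vertices along non-matching edges and V-vertices along matching edges. Hence
-- an edge uv with u ∈ Z and v ∉ Z is impossible: if uv ∉ M the path to u extends
-- to v, and if uv ∈ M then u (being saturated) was entered along its matching
-- edge, which is uv. So K = (U ∖ Z) ∪ (V ∩ Z) is a cover. It is minimal: a vertex
-- v ∈ V ∩ Z was entered from some u ∈ Z, so v alone covers uv inside K; a vertex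
-- u ∈ U ∖ Z is saturated (unsaturated vertices of U lie in Z), and its mate v is
-- not in Z (else u would be), so u alone covers the matching edge uv inside K.
module Submission where

open import Defs
open import Data.Bool using (Bool; true; false; not)
open import Data.Bool.Properties using () renaming (_≟_ to _≟ᵇ_)
open import Data.Empty using (⊥; ⊥-elim)
open import Data.Fin using (Fin; zero; suc; join; splitAt) renaming (_≟_ to _≟ᶠ_)
open import Data.Fin.Properties using (any?; injective⇒≤; splitAt-join)
open import Data.List using (List; []; _∷_; [_]; _++_; length; lookup)
open import Data.List.Membership.Propositional using (_∈_; _∉_)
open import Data.List.Membership.Propositional.Properties using (∈-lookup)
open import Data.List.Relation.Unary.All as All using ([])
open import Data.List.Relation.Unary.All.Properties using (++⁻ˡ)
open import Data.List.Relation.Unary.AllPairs using ([]; _∷_)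
open import Data.List.Relation.Unary.Any using (here; there)
open import Data.List.Relation.Unary.Unique.Propositional using (Unique)
open import Data.List.Relation.Unary.Unique.Propositional.Properties using (++⁺)
open import Data.Nat using (ℕ; zero; suc; _+_; _≤_; _≤′_; ≤′-refl; ≤′-step)
open import Data.Nat.Properties using (+-suc; +-identityʳ; ≤⇒≤′)
open import Data.Product using (Σ; ∃; _×_; _,_)
open import Data.Sum using (_⊎_; inj₁; inj₂; [_,_]′)
open import Data.Sum.Properties using (≡-dec)
open import Function using (_∘_)
open import Function.Definitions using (Injective)
open import Relation.Nullary using (¬_; Dec; yes; no)
open import Relation.Nullary.Decidable using (map′; ¬?; _⊎-dec_; _×-dec_)
open import Relation.Binary.PropositionalEquality using (_≡_; refl; sym; trans; cong; subst; module ≡-Reasoning)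

Unique-++⁻ˡ : ∀ {A : Set} (xs : List A) {ys} → Unique (xs ++ ys) → Unique xs
Unique-++⁻ˡ []       _         = []
Unique-++⁻ˡ (x ∷ xs) (x∉ ∷ uq) = ++⁻ˡ xs x∉ ∷ Unique-++⁻ˡ xs uq

Unique-∷ʳ : ∀ {A : Set} {xs : List A} {z} → Unique xs → z ∉ xs → Unique (xs ++ [ z ])
Unique-∷ʳ uq z∉ = ++⁺ uq ([] ∷ []) λ { (z∈ , here refl) → z∉ z∈ ; (_ , there ()) }

Unique⇒lookup-injective : ∀ {A : Set} {xs : List A} → Unique xs → Injective _≡_ _≡_ (lookup xs)
Unique⇒lookup-injective {xs = _ ∷ _} _         {zero}  {zero}  _  = refl
Unique⇒lookup-injective              (x∉ ∷ _)  {zero}  {suc j} eq = ⊥-elim (All.lookup x∉ (∈-lookup j) eq)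
Unique⇒lookup-injective              (x∉ ∷ _)  {suc i} {zero}  eq = ⊥-elim (All.lookup x∉ (∈-lookup i) (sym eq))
Unique⇒lookup-injective              (_ ∷ uq)  {suc i} {suc j} eq = cong suc (Unique⇒lookup-injective uq eq)

Unique⇒length≤ : ∀ {A : Set} {k} {f : A → Fin k} → Injective _≡_ _≡_ f →
                 ∀ {xs} → Unique xs → length xs ≤ k
Unique⇒length≤ f-injective uq = injective⇒≤ (Unique⇒lookup-injective uq ∘ f-injective)

join-injective : ∀ m n → Injective _≡_ _≡_ (join m n)
join-injective m n {x} {y} eq = begin
  x                      ≡⟨ splitAt-join m n x ⟨
  splitAt m (join m n x) ≡⟨ cong (splitAt m) eq ⟩
  splitAt m (join m n y) ≡⟨ splitAt-join m n y ⟩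
  y                      ∎
  where open ≡-Reasoning

_≟ᵛ_ : ∀ {m n} (x y : Vertex m n) → Dec (x ≡ y)
_≟ᵛ_ = ≡-dec _≟ᶠ_ _≟ᶠ_

any?-Vertex : ∀ {m n} {P : Vertex m n → Set} → (∀ x → Dec (P x)) → Dec (∃ P)
any?-Vertex {P = P} P? =
  map′ [ (λ (i , p) → inj₁ i , p) , (λ (j , p) → inj₂ j , p) ]′ split
       (any? (P? ∘ inj₁) ⊎-dec any? (P? ∘ inj₂))
  where
  split : ∃ P → ∃ (P ∘ inj₁) ⊎ ∃ (P ∘ inj₂)
  split (inj₁ i , p) = inj₁ (i , p)
  split (inj₂ j , p) = inj₂ (j , p)

module AlternatingReachability {m n : ℕ} (E M : BipEdges m n) where

  open import Data.List.Membership.DecPropositional (_≟ᵛ_ {m} {n}) using (_∈?_)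

  side : Vertex m n → Bool
  side (inj₁ _) = false
  side (inj₂ _) = true

  side-adj : ∀ {x y} → Adj E x y → side y ≡ not (side x)
  side-adj {inj₁ _} {inj₂ _} _ = refl
  side-adj {inj₂ _} {inj₁ _} _ = refl
  side-adj {inj₁ _} {inj₁ _} ()
  side-adj {inj₂ _} {inj₂ _} ()

  AltStep : Vertex m n → Vertex m n → Set
  AltStep x y = Adj E x y × edge M x y ≡ side x

  Source : Vertex m n → Set
  Source (inj₁ u) = ¬ Saturated M (inj₁ u)
  Source (inj₂ _) = ⊥

  -- Whether an edge appended to the walk must lie in M.
  nextBit : ∀ {b x y} → AltWalk E M b x y → Bool
  nextBit {b} here         = b
  nextBit     (step _ _ w) = nextBit w

  nextBit-side : ∀ {b x y} (w : AltWalk E M b x y) → b ≡ side x → nextBit w ≡ side y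
  nextBit-side here         b≡ = b≡
  nextBit-side (step a _ w) b≡ = nextBit-side w (trans (cong not b≡) (sym (side-adj a)))

  walk-snoc : ∀ {b x y z} (w : AltWalk E M b x y) → Adj E y z → edge M y z ≡ nextBit w →
              Σ (AltWalk E M b x z) λ w′ → altVerts w′ ≡ altVerts w ++ [ z ]
  walk-snoc here         a e = step a e here , refl
  walk-snoc (step a′ e′ w) a e with w′ , vs≡ ← walk-snoc w a e = step a′ e′ w′ , cong (_ ∷_) vs≡

  walk-prefix : ∀ {b x y z} (w : AltWalk E M b x y) → z ∈ altVerts w →
                Σ (AltWalk E M b x z) λ w′ → ∃ λ zs → altVerts w ≡ altVerts w′ ++ zs
  walk-prefix here         (here refl) = here , [] , refl
  walk-prefix (step _ _ w) (here refl) = here , altVerts w , refl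
  walk-prefix (step a e w) (there z∈)  with w′ , zs , vs≡ ← walk-prefix w z∈ =
    step a e w′ , zs , cong (_ ∷_) vs≡

  walk-init : ∀ {b x y z} (a : Adj E x y) (e : edge M x y ≡ b) (w : AltWalk E M (not b) y z) →
              ∃ λ p → Σ (AltWalk E M b x p) λ w′ → Adj E p z × edge M p z ≡ nextBit w′ ×
                altVerts (step a e w) ≡ altVerts w′ ++ [ z ]
  walk-init a e here = _ , here , a , e , refl
  walk-init a e (step a₂ e₂ w) with p , w′ , a′ , e′ , vs≡ ← walk-init a₂ e₂ w =
    p , step a e w′ , a′ , e′ , cong (_ ∷_) vs≡

  AltReach : Vertex m n → Set
  AltReach y = ∃ λ u → ¬ Saturated M (inj₁ u) ×
                 Σ (AltWalk E M false (inj₁ u) y) λ w → Unique (altVerts w)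

  Z⇒AltReach : ∀ {y} → Z E M y → AltReach y
  Z⇒AltReach (u , unsat , false , w , uq)                = u , unsat , w , uq
  Z⇒AltReach (u , unsat , true , here , uq)              = u , unsat , here , uq
  Z⇒AltReach (u , unsat , true , step {y = y} _ e _ , _) = ⊥-elim (unsat (y , e))

  prefix⇒Z : ∀ {u y zs} → ¬ Saturated M (inj₁ u) → (w : AltWalk E M false (inj₁ u) y) →
             Unique (altVerts w ++ zs) → Z E M y
  prefix⇒Z unsat w uq = _ , unsat , false , w , Unique-++⁻ˡ (altVerts w) uq

  Z-source : ∀ {y} → Source y → Z E M y
  Z-source {inj₁ u} unsat = u , unsat , false , here , [] ∷ []

  Z-step : ∀ {x y} → Z E M x → AltStep x y → Z E M y
  Z-step {y = y} zx (a , e) with u , unsat , w , uq ← Z⇒AltReach zx | y ∈? altVerts w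
  ... | yes y∈w with w′ , zs , vs≡ ← walk-prefix w y∈w = prefix⇒Z unsat w′ (subst Unique vs≡ uq)
  ... | no  y∉w with w′ , vs≡ ← walk-snoc w a (trans e (sym (nextBit-side w refl))) =
    _ , unsat , false , w′ , subst Unique (sym vs≡) (Unique-∷ʳ uq y∉w)

  Z-last : ∀ {y} → Z E M y → Source y ⊎ ∃ λ x → Z E M x × AltStep x y
  Z-last zy with Z⇒AltReach zy
  ... | _ , unsat , here , _ = inj₁ unsat
  ... | _ , unsat , step a e w , uq with x , w′ , a′ , e′ , vs≡ ← walk-init a e w =
    inj₂ (x , prefix⇒Z unsat w′ (subst Unique vs≡ uq) , a′ , trans e′ (nextBit-side w′ refl))

  -- Z is decided through its approximations by at most k alternating steps; a path
  -- has at most m + n vertices, so k = m + n already gives all of Z.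
  Reach≤ : ℕ → Vertex m n → Set
  Reach≤ zero    y = Source y
  Reach≤ (suc k) y = Reach≤ k y ⊎ ∃ λ x → Reach≤ k x × AltStep x y

  Saturated? : ∀ x → Dec (Saturated M x)
  Saturated? x = any?-Vertex λ y → edge M x y ≟ᵇ true

  AltStep? : ∀ x y → Dec (AltStep x y)
  AltStep? x y = (edge E x y ≟ᵇ true) ×-dec (edge M x y ≟ᵇ side x)

  Reach≤? : ∀ k y → Dec (Reach≤ k y)
  Reach≤? zero    (inj₁ u) = ¬? (Saturated? (inj₁ u))
  Reach≤? zero    (inj₂ _) = no λ ()
  Reach≤? (suc k) y        = Reach≤? k y ⊎-dec any?-Vertex λ x → Reach≤? k x ×-dec AltStep? x y

  Reach≤-mono : ∀ {k k′ y} → k ≤′ k′ → Reach≤ k y → Reach≤ k′ y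
  Reach≤-mono ≤′-refl      r = r
  Reach≤-mono (≤′-step k≤) r = inj₁ (Reach≤-mono k≤ r)

  Reach≤⇒Z : ∀ k {y} → Reach≤ k y → Z E M y
  Reach≤⇒Z zero    r                  = Z-source r
  Reach≤⇒Z (suc k) (inj₁ r)           = Reach≤⇒Z k r
  Reach≤⇒Z (suc k) (inj₂ (_ , r , s)) = Z-step (Reach≤⇒Z k r) s

  walk⇒Reach≤ : ∀ {b x y k} (w : AltWalk E M b x y) → b ≡ side x →
                Reach≤ k x → Reach≤ (length (altVerts w) + k) y
  walk⇒Reach≤ here _ r = inj₁ r
  walk⇒Reach≤ {x = x} {y} {k} (step a e w) b≡ r =
    subst (λ i → Reach≤ i y) (+-suc (length (altVerts w)) k)
      (walk⇒Reach≤ w (trans (cong not b≡) (sym (side-adj a))) (inj₂ (x , r , a , trans e b≡)))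

  Z⇒Reach≤ : ∀ {y} → Z E M y → Reach≤ (m + n) y
  Z⇒Reach≤ zy with _ , unsat , w , uq ← Z⇒AltReach zy = Reach≤-mono (≤⇒≤′ |w|≤) (walk⇒Reach≤ w refl unsat)
    where
    |w|≤ : length (altVerts w) + 0 ≤ m + n
    |w|≤ = subst (_≤ m + n) (sym (+-identityʳ _)) (Unique⇒length≤ (join-injective m n) uq)

  Z? : ∀ y → Dec (Z E M y)
  Z? y = map′ (Reach≤⇒Z (m + n)) Z⇒Reach≤ (Reach≤? (m + n) y)

module _ {m n : ℕ} {E M : BipEdges m n} where
  open AlternatingReachability E M

  Z-mate : (∀ u v v′ → M u v ≡ true → M u v′ ≡ true → v ≡ v′) →
           ∀ {u v} → M u v ≡ true → Z E M (inj₁ u) → Z E M (inj₂ v)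
  Z-mate M-functional {u} {v} Muv u∈Z with Z-last u∈Z
  ... | inj₁ unsat                       = ⊥-elim (unsat (inj₂ v , Muv))
  ... | inj₂ (inj₂ v′ , v′∈Z , _ , Muv′) = subst (Z E M ∘ inj₂) (M-functional u v′ v Muv′ Muv) v′∈Z
  ... | inj₂ (inj₁ _ , _ , () , _)

  K-cover : IsMatching E M → VertexCover E (K E M)
  K-cover (_ , M-functional , _) u v Euv with Z? (inj₁ u)
  ... | no  u∉Z = inj₁ u∉Z
  ... | yes u∈Z with M u v in Muv
  ...   | false = inj₂ (Z-step u∈Z (Euv , Muv))
  ...   | true  = inj₂ (Z-mate M-functional Muv u∈Z)

  K-minimal : IsMatching E M → ∀ (S : Vertex m n → Set) → (∀ x → S x → K E M x) →
              ¬ ((∃ λ x → K E M x × ¬ S x) × VertexCover E S)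
  K-minimal (M⊆E , _) S S⊆K ((inj₁ u , u∉Z , u∉S) , S-cover) = u∉Z (Z-source u-unsaturated)
    where
    u-unsaturated : ¬ Saturated M (inj₁ u)
    u-unsaturated (inj₁ _ , ())
    u-unsaturated (inj₂ v , Muv) with S-cover u v (M⊆E u v Muv)
    ... | inj₁ u∈S = u∉S u∈S
    ... | inj₂ v∈S = u∉Z (Z-step (S⊆K (inj₂ v) v∈S) (M⊆E u v Muv , Muv))
  K-minimal _ S S⊆K ((inj₂ v , v∈Z , v∉S) , S-cover) with Z-last v∈Z
  ... | inj₂ (inj₂ _ , _ , () , _)
  ... | inj₂ (inj₁ u , u∈Z , Euv , _) with S-cover u v Euv
  ...   | inj₁ u∈S = S⊆K (inj₁ u) u∈S u∈Z
  ...   | inj₂ v∈S = v∉S v∈S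

  K-minimalVertexCover : IsMatching E M → MinimalVertexCover E (K E M)
  K-minimalVertexCover matching = K-cover matching , K-minimal matching

proposition4p2 : (m n : ℕ) (E : BipEdges m n) → Connected E → m ≤ n →
    (M : BipEdges m n) → IsMaximalMatching E M →
    MinimalVertexCover E (K E M)
proposition4p2 m n E _ _ M (matching , _) = K-minimalVertexCover matching
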